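{- Let $G$ be a graph containing no subgraph isomorphic to $C_6$, let $x\in V(G)$, and let $A$ be a connected component of $G[N_2(x)]$ which contains an odd cycle. Then $|N(x)\cap N(V(A))|=1$.
   Context: Graphs are finite, simple, undirected. For a nonempty set $S$ of vertices, $N(S)$ is the set of vertices at distance exactly $1$ from $S$ (so $N(S)\cap S=\emptyset$); $N(x)=N(\{x\})$; $N_2(x)$ is the set of vertices at distance exactly $2$ from $x$. "No subgraph isomorphic to $C_6$" refers to not necessarily induced subgraphs. -}

module Defs where

open import Data.Nat using (ℕ; zero; suc; _+_; _*_; _≤_)
open import Data.Fin using (Fin; zero; suc)
import Data.Fin
import Data.Nat
open import Data.Unit using (⊤)
open import Data.Fin.Properties using ()
open import Data.Product using (Σ; ∃; _×_; _,_)
open import Data.List using (List; []; _∷_)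
open import Data.Empty using (⊥)
open import Relation.Nullary using (¬_; yes; no; Dec)
open import Relation.Binary.PropositionalEquality using (_≡_)
open import Function.Definitions using (Injective)
open import Level using (0ℓ)

record Graph (n : ℕ) : Set₁ where
  field
    Adj     : Fin n → Fin n → Set
    sym     : ∀ {u v} → Adj u v → Adj v u
    irrefl  : ∀ {u} → ¬ Adj u u
    dec     : ∀ u v → Dec (Adj u v)

csuc : ∀ {k} → Fin (suc k) → Fin (suc k)
csuc {k} i with Data.Fin.toℕ i Data.Nat.<? k
... | yes p = suc (Data.Fin.fromℕ< p)
... | no _  = zero

module _ {n : ℕ} (G : Graph n) where
  open Graph G

  data WalkIn (P : Fin n → Set) : Fin n → Fin n → ℕ → Set where
    here : ∀ {u} → P u → WalkIn P u u zero
    step : ∀ {u w v k} → P u → Adj u w → WalkIn P w v k → WalkIn P u v (suc k)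

  Everywhere : Fin n → Set
  Everywhere _ = ⊤

  DistEq : Fin n → Fin n → ℕ → Set
  DistEq u v d = WalkIn Everywhere u v d
               × (∀ k → WalkIn Everywhere u v k → d ≤ k)

  N : Fin n → Fin n → Set
  N x v = DistEq x v 1

  N₂ : Fin n → Fin n → Set
  N₂ x v = DistEq x v 2

  NSet : (Fin n → Set) → Fin n → Set
  NSet S v = ¬ S v × Σ (Fin n) (λ s → S s × Adj s v)

  IsComponentOf : (Fin n → Set) → (Fin n → Set) → Set
  IsComponentOf P A =
    Σ (Fin n) λ a → P a ×
      (∀ v → A v → Σ ℕ λ k → WalkIn P a v k) ×
      (∀ v k → WalkIn P a v k → A v)

  -- A contains an odd cycle: a cycle C_{2m+3} (length >= 3, odd) all of
  -- whose vertices lie in A (edges of G between vertices of A are edges of G[A]).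
  ContainsOddCycle : (Fin n → Set) → Set
  ContainsOddCycle A =
    Σ ℕ λ m → Σ (Fin (suc (2 * m + 2)) → Fin n) λ f →
      Injective _≡_ _≡_ f ×
      (∀ i → A (f i)) ×
      (∀ i → Adj (f i) (f (csuc i)))

  HasC6 : Set
  HasC6 = Σ (Fin 6 → Fin n) λ f → Injective _≡_ _≡_ f × (∀ i → Adj (f i) (f (csuc i)))

  ExactlyOne : (Fin n → Set) → Set
  ExactlyOne P = Σ (Fin n) λ v → P v × (∀ w → P w → w ≡ v)

-- Call y a parent of u ∈ N₂(x) if y ∈ N(x) and
-- y ~ u, and say u and v agree when every parent of u equals every parent
-- of v.  The proof runs as follows.
--   * If a – b – c is a path in N₂(x) with a ≠ c, then a and c agree:
--     two different parents y ≠ y' of a and c would close the hexagon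
--     x y a b c y'.  (The six vertices are distinct because x, parents
--     and N₂(x) lie at the distinct distances 0, 1, 2 from x.)
--   * Agreement is symmetric and transitive through vertices of N₂(x), so
--     it propagates along walks of even length inside N₂(x).
--   * Walking around the odd cycle turns every walk inside the component
--     into one of even length, and a vertex c of the cycle agrees with
--     itself (it agrees with the vertex two steps further on the cycle).
--   * Hence all vertices of A agree with each other, so all of A has one
--     common parent y, which is the unique vertex of N(x) ∩ N(V(A)).
module Submission where

open import Defs
open import Data.Nat using (ℕ)
open import Data.Fin using (Fin)
open import Data.Product using (_×_)
open import Relation.Nullary using (¬_)

open import Data.Nat using (zero; suc; _+_; _*_; _≤_; _<_; s≤s; z≤n; _<?_)
open import Data.Nat.Properties using (+-suc; m≤n+m; <-irrefl; ≤-refl; ≤-antisym; <⇒≤)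
open import Data.Fin using (zero; suc; toℕ; _≟_)
open import Data.Fin.Properties using (toℕ-fromℕ<)
open import Data.Vec using (Vec; []; _∷_; lookup)
open import Data.Vec.Relation.Unary.All using ([]; _∷_)
open import Data.Vec.Relation.Unary.Unique.Propositional using (Unique; []; _∷_)
open import Data.Vec.Relation.Unary.Unique.Propositional.Properties using (lookup-injective)
open import Data.Product using (Σ; _,_; proj₂)
open import Data.Sum using (_⊎_; inj₁; inj₂)
open import Data.Unit using (⊤; tt)
open import Data.Empty using (⊥; ⊥-elim)
open import Relation.Nullary using (yes; no)
open import Relation.Binary.PropositionalEquality using (_≡_; _≢_; refl; sym; trans; subst; cong)
open import Function.Definitions using (Injective)

csuc^ : ∀ {k} → ℕ → Fin (suc k)
csuc^ zero    = zero
csuc^ (suc j) = csuc (csuc^ j)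

toℕ-csuc : ∀ {k} (i : Fin (suc k)) → toℕ i < k → toℕ (csuc i) ≡ suc (toℕ i)
toℕ-csuc {k} i i<k with toℕ i <? k
... | yes p = cong suc (toℕ-fromℕ< p)
... | no ¬p = ⊥-elim (¬p i<k)

csuc-last : ∀ {k} (i : Fin (suc k)) → toℕ i ≡ k → csuc i ≡ zero
csuc-last {k} i i≡k with toℕ i <? k
... | yes p = ⊥-elim (<-irrefl i≡k p)
... | no _  = refl

toℕ-csuc^ : ∀ {k} j → j ≤ k → toℕ (csuc^ {k} j) ≡ j
toℕ-csuc^ zero    _   = refl
toℕ-csuc^ {k} (suc j) j<k =
  trans (toℕ-csuc (csuc^ j) (subst (_< k) (sym ih) j<k)) (cong suc ih)
  where
  ih : toℕ (csuc^ {k} j) ≡ j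
  ih = toℕ-csuc^ j (<⇒≤ j<k)

csuc^-wraps : ∀ {k} → csuc^ {k} (suc k) ≡ zero
csuc^-wraps {k} = csuc-last (csuc^ k) (toℕ-csuc^ k ≤-refl)

-- Parity, as a computing predicate so that parity facts reduce by matching.
Even : ℕ → Set
Even zero          = ⊤
Even (suc zero)    = ⊥
Even (suc (suc k)) = Even k

Odd : ℕ → Set
Odd k = Even (suc k)

even-or-odd : ∀ k → Even k ⊎ Odd k
even-or-odd zero          = inj₁ tt
even-or-odd (suc zero)    = inj₂ tt
even-or-odd (suc (suc k)) = even-or-odd k

even+even : ∀ i j → Even i → Even j → Even (i + j)
even+even zero          j _  ej = ej
even+even (suc (suc i)) j ei ej = even+even i j ei ej

odd+odd : ∀ i j → Odd i → Odd j → Even (i + j)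
odd+odd (suc zero)    j _  oj = oj
odd+odd (suc (suc i)) j oi oj = odd+odd i j oi oj

even-double : ∀ m → Even (2 * m)
even-double zero    = tt
even-double (suc m) rewrite +-suc m (m + 0) = even-double m

odd-cycle-length : ∀ m → Odd (suc (2 * m + 2))
odd-cycle-length m = even+even (2 * m) 2 (even-double m) tt

module _ {n : ℕ} (G : Graph n) where
  open Graph G renaming (sym to adj-sym)

  walk-start : ∀ {Q u v k} → WalkIn G Q u v k → Q u
  walk-start (here q)     = q
  walk-start (step q _ _) = q

  walk-end : ∀ {Q u v k} → WalkIn G Q u v k → Q v
  walk-end (here q)     = q
  walk-end (step _ _ w) = walk-end w

  snoc : ∀ {Q u v w k} → WalkIn G Q u v k → Adj v w → Q w → WalkIn G Q u w (suc k)
  snoc (here q)      vw qw = step q vw (here qw)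
  snoc (step q uw w) vw qw = step q uw (snoc w vw qw)

  reverse : ∀ {Q u v k} → WalkIn G Q u v k → WalkIn G Q v u k
  reverse (here q)      = here q
  reverse (step q uw w) = snoc (reverse w) (adj-sym uw) q

  _++_ : ∀ {Q u v w k j} → WalkIn G Q u v k → WalkIn G Q v w j → WalkIn G Q u w (k + j)
  here _      ++ w' = w'
  step q uw w ++ w' = step q uw (w ++ w')

  cycle-walk : ∀ {Q k} (f : Fin (suc k) → Fin n) → (∀ i → Q (f i)) →
               (∀ i → Adj (f i) (f (csuc i))) → WalkIn G Q (f zero) (f zero) (suc k)
  cycle-walk {Q} {k} f q adj =
    subst (λ i → WalkIn G Q (f zero) (f i) (suc k)) csuc^-wraps (around (suc k))
    where
    around : ∀ j → WalkIn G Q (f zero) (f (csuc^ j)) j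
    around zero    = here (q zero)
    around (suc j) = snoc (around j) (adj (csuc^ j)) (q _)

  even-walk-from : ∀ {Q c v k L} → WalkIn G Q c c L → Odd L → WalkIn G Q c v k →
                   Σ ℕ λ j → WalkIn G Q c v j × Even j
  even-walk-from {k = k} {L} cyc oddL w with even-or-odd k
  ... | inj₁ ek = k , w , ek
  ... | inj₂ ok = L + k , cyc ++ w , odd+odd L k oddL ok

  component⊆ : ∀ {P A v} → IsComponentOf G P A → A v → P v
  component⊆ (_ , _ , reach , _) av = walk-end (proj₂ (reach _ av))

  component-walk : ∀ {P A u v} → IsComponentOf G P A → A u → A v →
                   Σ ℕ λ k → WalkIn G P u v k
  component-walk (_ , _ , reach , _) au av with reach _ au | reach _ av
  ... | k₁ , w₁ | k₂ , w₂ = k₁ + k₂ , reverse w₁ ++ w₂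

  dist-unique : ∀ {u v d e} → DistEq G u v d → DistEq G u v e → d ≡ e
  dist-unique (w , min) (w' , min') = ≤-antisym (min _ w') (min' _ w)

  apart : ∀ {x u v d e} → DistEq G x u d → DistEq G x v e → d ≢ e → u ≢ v
  apart du dv d≢e refl = d≢e (dist-unique du dv)

  dist-self : ∀ {x} → DistEq G x x 0
  dist-self = here tt , λ _ _ → z≤n

  adj-≢ : ∀ {u v} → Adj u v → u ≢ v
  adj-≢ uv refl = irrefl uv

  adj⇒N : ∀ {x y} → Adj x y → N G x y
  adj⇒N xy = step tt xy (here tt) , λ { zero (here _) → ⊥-elim (irrefl xy)
                                       ; (suc _) _   → s≤s z≤n }

  N⇒adj : ∀ {x y} → N G x y → Adj x y
  N⇒adj (step _ xy (here _) , _) = xy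

  hexagon : (vs : Vec (Fin n) 6) → Unique vs →
            (∀ i → Adj (lookup vs i) (lookup vs (csuc i))) → HasC6 G
  hexagon vs distinct adj = lookup vs , (λ {i} {j} → lookup-injective distinct i j) , adj

module Agreement {n : ℕ} (G : Graph n) (x : Fin n) where
  open Graph G using (Adj)

  Parent : Fin n → Fin n → Set
  Parent u y = Adj x y × Adj y u

  parent : ∀ {u} → N₂ G x u → Σ (Fin n) (Parent u)
  parent (step _ xy (step _ yu (here _)) , _) = _ , xy , yu

  Agree : Fin n → Fin n → Set
  Agree u v = ∀ {y y'} → Parent u y → Parent v y' → y ≡ y'

  agree-sym : ∀ {u v} → Agree u v → Agree v u
  agree-sym uv pv pu = sym (uv pu pv)

  -- Transitivity needs the middle vertex to have a parent.
  agree-trans : ∀ {u b c} → Agree u b → Agree b c → N₂ G x b → Agree u c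
  agree-trans ub bc nb pu pc with parent nb
  ... | _ , pb = trans (ub pu pb) (bc pb pc)

module _ {n : ℕ} (G : Graph n) (noC6 : ¬ HasC6 G) (x : Fin n) where
  open Graph G renaming (sym to adj-sym)
  open Agreement G x

  agree-over-path : ∀ {a b c} → N₂ G x a → N₂ G x b → N₂ G x c → a ≢ c →
                    Adj a b → Adj b c → Agree a c
  agree-over-path {a} {b} {c} na nb nc a≢c ab bc {y} {y'} (xy , ya) (xy' , y'c)
    with y ≟ y'
  ... | yes y≡y' = y≡y'
  ... | no  y≢y' = ⊥-elim (noC6 (hexagon G (x ∷ y ∷ a ∷ b ∷ c ∷ y' ∷ []) distinct edges))
    where
    dx = dist-self G
    dy = adj⇒N G xy
    dy' = adj⇒N G xy'

    -- x, the parents and a, b, c are at distances 0, 1 and 2 from x.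
    distinct : Unique (x ∷ y ∷ a ∷ b ∷ c ∷ y' ∷ [])
    distinct =
        (apart G dx dy (λ ()) ∷ apart G dx na (λ ()) ∷ apart G dx nb (λ ())
          ∷ apart G dx nc (λ ()) ∷ apart G dx dy' (λ ()) ∷ [])
      ∷ (apart G dy na (λ ()) ∷ apart G dy nb (λ ()) ∷ apart G dy nc (λ ())
          ∷ y≢y' ∷ [])
      ∷ (adj-≢ G ab ∷ a≢c ∷ apart G na dy' (λ ()) ∷ [])
      ∷ (adj-≢ G bc ∷ apart G nb dy' (λ ()) ∷ [])
      ∷ (apart G nc dy' (λ ()) ∷ [])
      ∷ [] ∷ []

    edges : ∀ i → Adj (lookup (x ∷ y ∷ a ∷ b ∷ c ∷ y' ∷ []) i)
                      (lookup (x ∷ y ∷ a ∷ b ∷ c ∷ y' ∷ []) (csuc i))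
    edges zero                                = xy
    edges (suc zero)                          = ya
    edges (suc (suc zero))                    = ab
    edges (suc (suc (suc zero)))              = bc
    edges (suc (suc (suc (suc zero))))        = adj-sym y'c
    edges (suc (suc (suc (suc (suc zero))))) = adj-sym xy'

  agree-along : ∀ {s a v k} → WalkIn G (N₂ G x) a v k → Even k → Agree s a → Agree s v
  agree-along (here _)              _  sa = sa
  agree-along (step _ _ (here _))   () _
  agree-along {a = a} (step na ab (step {w = c} nb bc w)) ek sa with a ≟ c
  ... | yes refl = agree-along w ek sa
  ... | no  a≢c  =
    agree-along w ek (agree-trans sa (agree-over-path na nb (walk-start G w) a≢c ab bc) na)

  -- A vertex on a cycle of length at least 3 inside N₂(x) has only one
  -- parent: it agrees with the vertex two steps further along the cycle.
  cycle-agree : ∀ {k} → 2 ≤ k → (f : Fin (suc k) → Fin n) → Injective _≡_ _≡_ f →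
                (∀ i → N₂ G x (f i)) → (∀ i → Adj (f i) (f (csuc i))) →
                Agree (f zero) (f zero)
  cycle-agree {k} 2≤k f f-inj inN₂ adj =
    agree-trans f₀~f₂ (agree-sym f₀~f₂) (inN₂ (csuc^ 2))
    where
    f₂≢f₀ : f (csuc^ 2) ≢ f zero
    f₂≢f₀ eq with trans (sym (toℕ-csuc^ {k} 2 2≤k)) (cong toℕ (f-inj eq))
    ... | ()

    f₀~f₂ : Agree (f zero) (f (csuc^ 2))
    f₀~f₂ = agree-over-path (inN₂ _) (inN₂ _) (inN₂ _) (λ eq → f₂≢f₀ (sym eq))
                            (adj zero) (adj (csuc zero))

  component-agree : ∀ {A u v} → IsComponentOf G (N₂ G x) A → ContainsOddCycle G A →
                    A u → A v → Agree u v
  component-agree {A} comp (m , f , f-inj , f∈A , adj) au av =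
    agree-trans (agree-sym (agrees au)) (agrees av) (inN₂ zero)
    where
    inN₂ : ∀ i → N₂ G x (f i)
    inN₂ i = component⊆ G comp (f∈A i)

    agrees : ∀ {w} → A w → Agree (f zero) w
    agrees aw with even-walk-from G (cycle-walk G f inN₂ adj) (odd-cycle-length m)
                                    (proj₂ (component-walk G comp (f∈A zero) aw))
    ... | _ , walk , even =
      agree-along walk even (cycle-agree (m≤n+m 2 (2 * m)) f f-inj inN₂ adj)

-- The root r of A has a parent y; every vertex of N(x) ∩ N(V(A)) is a
-- parent of some vertex of A, hence equals y because A agrees with r.
lemma3 : {n : ℕ} (G : Graph n) → ¬ HasC6 G → (x : Fin n) (A : Fin n → Set) →
    IsComponentOf G (N₂ G x) A → ContainsOddCycle G A →
    ExactlyOne G (λ v → N G x v × NSet G A v)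
lemma3 G noC6 x A comp@(r , r∈N₂ , _ , reach) odd-cycle
  with Agreement.parent G x r∈N₂
... | y , xy , yr = y , (adj⇒N G xy , y∉A , r , r∈A , Graph.sym G yr) , only-y
  where
  r∈A : A r
  r∈A = reach r 0 (here r∈N₂)

  y∉A : ¬ A y
  y∉A ay = apart G (adj⇒N G xy) (component⊆ G comp ay) (λ ()) refl

  only-y : ∀ w → N G x w × NSet G A w → w ≡ y
  only-y w (xw , _ , s , s∈A , sw) =
    component-agree G noC6 x comp odd-cycle s∈A r∈A (N⇒adj G xw , Graph.sym G sw) (xy , yr)
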